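{- For any sequences $\mathbf q,\mathbf s\in\mathcal V_{v,c}$ and any $i\in\{1,\dots,v\}$ with $s_i\ge1$, we have $$P(\mathbf q,\mathbf s^i)\,P(\mathbf s,\mathbf q)=s_i\,P(\mathbf q,\mathbf s)\,P(\mathbf s^i,\mathbf q).$$
   Context: $\mathcal V_{v,c}$ is the set of non-increasing sequences $(s_1,\dots,s_v)$ of non-negative integers with sum $c$. For $\mathbf s\in\mathcal V_{v,c}$ with $s_i\ge1$, $\mathbf s^i\in\mathcal V_{v,c-1}$ is the vector obtained from $\mathbf s$ by decreasing the $i$-th entry by $1$ and reordering the result non-increasingly. For $\mathbf s\in\mathcal V_{v,c}$ and $\mathbf q\in\mathcal V_{v,d}$, $P(\mathbf s,\mathbf q)$ is the product, over all $i$ with $s_i>q_i$, of $s_i(s_i-1)\cdots(q_i+1)$; if $q_i\ge s_i$ for all $i$, then $P(\mathbf s,\mathbf q)=1$. -}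

module Defs where

open import Data.Nat using (ℕ; zero; suc; _+_; _*_; _∸_; _≥_; _≤_; _≤ᵇ_)
open import Data.Bool using (if_then_else_)
open import Data.Fin using (Fin)
open import Data.Vec using (Vec; []; _∷_; lookup; updateAt; foldr; zipWith)

vsum : ∀ {v} → Vec ℕ v → ℕ
vsum = foldr _ _+_ 0

data NonIncreasing : ∀ {v} → Vec ℕ v → Set where
  ni-[]  : NonIncreasing []
  ni-[x] : ∀ x → NonIncreasing (x ∷ [])
  ni-∷   : ∀ {v} x y (ys : Vec ℕ v) → x ≥ y → NonIncreasing (y ∷ ys) → NonIncreasing (x ∷ y ∷ ys)

InV : ∀ v → ℕ → Vec ℕ v → Set
InV v c s = NonIncreasing s × vsum s ≡ c
  where
    open import Data.Product using (_×_)
    open import Relation.Binary.PropositionalEquality using (_≡_)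

insertDesc : ∀ {v} → ℕ → Vec ℕ v → Vec ℕ (suc v)
insertDesc x [] = x ∷ []
insertDesc x (y ∷ ys) = if y ≤ᵇ x then x ∷ y ∷ ys else y ∷ insertDesc x ys

sortDesc : ∀ {v} → Vec ℕ v → Vec ℕ v
sortDesc [] = []
sortDesc (x ∷ xs) = insertDesc x (sortDesc xs)

dec : ∀ {v} → Vec ℕ v → Fin v → Vec ℕ v
dec s i = sortDesc (updateAt s i (λ x → x ∸ 1))

-- fall a b = a (a-1) ⋯ (b+1) if a > b, and 1 otherwise
fall : ℕ → ℕ → ℕ
fall zero    b = 1
fall (suc a) b = if suc a ≤ᵇ b then 1 else suc a * fall a b

vprod : ∀ {v} → Vec ℕ v → ℕ
vprod = foldr _ _*_ 1

P : ∀ {v} → Vec ℕ v → Vec ℕ v → ℕ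
P s q = vprod (zipWith fall s q)

-- Clearing denominators, P(𝐬,𝐪) = ∏ s_j! / ∏ q_j! · P(𝐪,𝐬), since entrywise
-- fall a b · b! = fall b a · a! (both equal max(a,b)!).  Hence each side of the
-- identity is a ratio of products of factorials, and the claim reduces to
-- ∏ s_j! = s_i · ∏ (𝐬^i)_j!, which holds because reordering does not change
-- a product and s_i! = s_i · (s_i - 1)!.
module Submission where

open import Defs
open import Data.Nat using (ℕ; zero; suc; z≤n; _*_; _∸_; _≤_; _≥_; _≤ᵇ_; _!; NonZero)
open import Data.Nat.Properties
open import Data.Nat.Tactic.RingSolver using (solve-∀)
open import Data.Bool using (true; false)
open import Data.Fin using (Fin)
open import Data.Sum using (inj₁; inj₂)
open import Data.Vec using (Vec; []; _∷_; lookup; updateAt; map)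
open import Relation.Nullary using (contradiction)
open import Relation.Nullary.Reflects using (ofʸ; ofⁿ)
open import Relation.Binary.PropositionalEquality
  using (_≡_; refl; sym; trans; cong; cong₂; module ≡-Reasoning)

open ≡-Reasoning

fall-≤ : ∀ {a b} → a ≤ b → fall a b ≡ 1
fall-≤ {zero}      _   = refl
fall-≤ {suc a} {b} a<b with suc a ≤ᵇ b | ≤ᵇ-reflects-≤ (suc a) b
... | true  | _        = refl
... | false | ofⁿ a≮b  = contradiction a<b a≮b

fall-suc : ∀ {a b} → b ≤ a → fall (suc a) b ≡ suc a * fall a b
fall-suc {a} {b} b≤a with suc a ≤ᵇ b | ≤ᵇ-reflects-≤ (suc a) b
... | true  | ofʸ a<b = contradiction b≤a (<⇒≱ a<b)
... | false | _       = refl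

fall*!≡! : ∀ {a b} → b ≤ a → fall a b * b ! ≡ a !
fall*!≡! {zero} z≤n = refl
fall*!≡! {suc a} {b} b≤1+a with m≤n⇒m<n∨m≡n b≤1+a
... | inj₂ refl rewrite fall-≤ (≤-refl {suc a}) = *-identityˡ _
... | inj₁ b<1+a = begin
  fall (suc a) b * b !    ≡⟨ cong (_* b !) (fall-suc b≤a) ⟩
  suc a * fall a b * b !  ≡⟨ *-assoc (suc a) (fall a b) (b !) ⟩
  suc a * (fall a b * b !) ≡⟨ cong (suc a *_) (fall*!≡! b≤a) ⟩
  suc a * a !             ∎
  where b≤a = ≤-pred b<1+a

fall*!-comm : ∀ a b → fall a b * b ! ≡ fall b a * a !
fall*!-comm a b with ≤-total a b
... | inj₁ a≤b rewrite fall-≤ a≤b = trans (*-identityˡ _) (sym (fall*!≡! a≤b))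
... | inj₂ b≤a rewrite fall-≤ b≤a = trans (fall*!≡! b≤a) (sym (*-identityˡ _))

prod! : ∀ {v} → Vec ℕ v → ℕ
prod! s = vprod (map _! s)

prod!-nonZero : ∀ {v} (s : Vec ℕ v) → NonZero (prod! s)
prod!-nonZero []       = _
prod!-nonZero (x ∷ xs) = m*n≢0 (x !) (prod! xs) {{x !≢0}} {{prod!-nonZero xs}}

interchange : ∀ w x y z → w * x * (y * z) ≡ w * y * (x * z)
interchange = solve-∀

left-comm : ∀ x y z → x * (y * z) ≡ y * (x * z)
left-comm = solve-∀

P*prod!-comm : ∀ {v} (s q : Vec ℕ v) → P s q * prod! q ≡ P q s * prod! s
P*prod!-comm []       []       = refl
P*prod!-comm (a ∷ as) (b ∷ bs) = begin
  fall a b * P as bs * (b ! * prod! bs) ≡⟨ interchange (fall a b) _ _ _ ⟩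
  fall a b * b ! * (P as bs * prod! bs) ≡⟨ cong₂ _*_ (fall*!-comm a b) (P*prod!-comm as bs) ⟩
  fall b a * a ! * (P bs as * prod! as) ≡⟨ interchange (fall b a) _ _ _ ⟩
  fall b a * P bs as * (a ! * prod! as) ∎

prod!-insertDesc : ∀ {v} x (ys : Vec ℕ v) → prod! (insertDesc x ys) ≡ x ! * prod! ys
prod!-insertDesc x []       = refl
prod!-insertDesc x (y ∷ ys) with y ≤ᵇ x
... | true  = refl
... | false = trans (cong (y ! *_) (prod!-insertDesc x ys)) (left-comm (y !) (x !) _)

prod!-sortDesc : ∀ {v} (xs : Vec ℕ v) → prod! (sortDesc xs) ≡ prod! xs
prod!-sortDesc []       = refl
prod!-sortDesc (x ∷ xs) =
  trans (prod!-insertDesc x (sortDesc xs)) (cong (x ! *_) (prod!-sortDesc xs))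

prod!-updateAt-pred : ∀ {v} (s : Vec ℕ v) i → lookup s i ≥ 1 →
  prod! s ≡ lookup s i * prod! (updateAt s i (_∸ 1))
prod!-updateAt-pred (suc x ∷ xs) Fin.zero    _  = *-assoc (suc x) (x !) _
prod!-updateAt-pred (x ∷ xs)     (Fin.suc i) si≥1 =
  trans (cong (x ! *_) (prod!-updateAt-pred xs i si≥1)) (left-comm (x !) (lookup xs i) _)

prod!-dec : ∀ {v} (s : Vec ℕ v) i → lookup s i ≥ 1 → prod! s ≡ lookup s i * prod! (dec s i)
prod!-dec s i si≥1 = trans (prod!-updateAt-pred s i si≥1)
  (cong (lookup s i *_) (sym (prod!-sortDesc (updateAt s i (_∸ 1)))))

lemma2p2 : (v c : ℕ) (q s : Vec ℕ v) → InV v c q → InV v c s →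
    (i : Fin v) → lookup s i ≥ 1 →
    P q (dec s i) * P s q ≡ lookup s i * P q s * P (dec s i) q
lemma2p2 v c q s _ _ i si≥1 = *-cancelʳ-≡ _ _ (prod! q) {{prod!-nonZero q}} (begin
  P q s' * P s q * prod! q               ≡⟨ *-assoc (P q s') _ _ ⟩
  P q s' * (P s q * prod! q)             ≡⟨ cong (P q s' *_) (P*prod!-comm s q) ⟩
  P q s' * (P q s * prod! s)             ≡⟨ cong (λ x → P q s' * (P q s * x)) (prod!-dec s i si≥1) ⟩
  P q s' * (P q s * (sᵢ * prod! s'))     ≡⟨ rearrange (P q s') (P q s) sᵢ _ ⟩
  sᵢ * P q s * (P q s' * prod! s')       ≡⟨ cong (sᵢ * P q s *_) (sym (P*prod!-comm s' q)) ⟩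
  sᵢ * P q s * (P s' q * prod! q)        ≡⟨ *-assoc (sᵢ * P q s) _ _ ⟨
  sᵢ * P q s * P s' q * prod! q          ∎)
  where
  s' = dec s i
  sᵢ = lookup s i
  rearrange : ∀ a b x y → a * (b * (x * y)) ≡ x * b * (a * y)
  rearrange = solve-∀
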